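{- Let $G=(C,I,E)$ be a connected block-split graph that is not a tree and is not isomorphic to $K_3$. Then $G$ admits a HIST if and only if $G$ contains at least two good vertices.
   Context: All graphs are finite, simple and undirected. A HIST (homeomorphically irreducible spanning tree) of a connected graph $G$ is a spanning tree of $G$ with no vertex of degree exactly $2$ in the tree. A split graph $G=(C,I,E)$ is a graph whose vertex set is partitioned into $C$ and $I$, where $C$ induces a clique and $I$ induces an independent set. A block-split graph is a split graph $G=(C,I,E)$ in which every vertex of $I$ has degree at most one (so, when $G$ is connected, every vertex of $I$ is a pendant vertex adjacent to exactly one vertex of $C$). A vertex $u\in C$ is called good if its degree $d(u)$ in $G$ satisfies $d(u)\neq |C|$, and bad otherwise (equivalently, a good vertex of $C$ has either $0$ or at least $2$ neighbours in $I$, and a bad vertex has exactly one neighbour in $I$). -}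

module Defs where

open import Data.Nat using (ℕ; _≤_)
open import Data.Bool using (Bool; true; false; not)
open import Data.Fin using (Fin)
open import Data.List using (List; []; _∷_; _++_; length; filterᵇ; allFin)
open import Data.List.Relation.Unary.Linked using (Linked)
open import Data.List.Relation.Unary.Unique.Propositional using (Unique)
open import Data.Product using (Σ; _×_; ∃)
open import Relation.Binary.PropositionalEquality using (_≡_; _≢_)
open import Relation.Nullary using (¬_)
open import Function.Bundles using (_↔_; Inverse)

record Graph (n : ℕ) : Set where
  field
    adj    : Fin n → Fin n → Bool
    adj-sym : ∀ u v → adj u v ≡ adj v u
    adj-irr : ∀ v → adj v v ≡ false
open Graph public

Edge : ∀ {n} → (Fin n → Fin n → Bool) → Fin n → Fin n → Set
Edge E u v = E u v ≡ true

data Walk {n : ℕ} (E : Fin n → Fin n → Bool) : Fin n → Fin n → Set where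
  here : ∀ {v} → Walk E v v
  step : ∀ {u w v} → Edge E u w → Walk E w v → Walk E u v

Connected : ∀ {n} → (Fin n → Fin n → Bool) → Set
Connected E = ∀ u v → Walk E u v

HasCycle : ∀ {n} → (Fin n → Fin n → Bool) → Set
HasCycle {n} E = Σ (Fin n) λ x → Σ (List (Fin n)) λ xs →
  (2 ≤ length xs) × Unique (x ∷ xs) × Linked (Edge E) (x ∷ xs ++ x ∷ [])

IsTree : ∀ {n} → (Fin n → Fin n → Bool) → Set
IsTree E = Connected E × ¬ HasCycle E

deg : ∀ {n} → (Fin n → Fin n → Bool) → Fin n → ℕ
deg {n} E v = length (filterᵇ (E v) (allFin n))

IsSpanningTree : ∀ {n} → Graph n → (Fin n → Fin n → Bool) → Set
IsSpanningTree G T =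
  (∀ u v → T u v ≡ T v u) × (∀ u v → Edge T u v → Edge (adj G) u v) × IsTree T

IsHIST : ∀ {n} → Graph n → (Fin n → Fin n → Bool) → Set
IsHIST G T = IsSpanningTree G T × (∀ v → deg T v ≢ 2)

HasHIST : ∀ {n} → Graph n → Set
HasHIST {n} G = Σ (Fin n → Fin n → Bool) λ T → IsHIST G T

K : (m : ℕ) → Graph m
K m = record { adj = λ u v → not (isYes (u Data.Fin.≟ v))
             ; adj-sym = λ u v → cong not (symDec u v)
             ; adj-irr = λ v → cong not (reflDec v) }
  where
  open import Relation.Nullary using (isYes)
  open import Relation.Binary.PropositionalEquality using (cong; refl; sym)
  import Data.Fin
  symDec : ∀ u v → isYes (u Data.Fin.≟ v) ≡ isYes (v Data.Fin.≟ u)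
  symDec u v with u Data.Fin.≟ v | v Data.Fin.≟ u
  ... | Relation.Nullary.yes _ | Relation.Nullary.yes _ = refl
  ... | Relation.Nullary.no _ | Relation.Nullary.no _ = refl
  ... | Relation.Nullary.yes p | Relation.Nullary.no q = Data.Empty.⊥-elim (q (sym p))
    where import Data.Empty
  ... | Relation.Nullary.no p | Relation.Nullary.yes q = Data.Empty.⊥-elim (p (sym q))
    where import Data.Empty
  reflDec : ∀ v → isYes (v Data.Fin.≟ v) ≡ true
  reflDec v with v Data.Fin.≟ v
  ... | Relation.Nullary.yes _ = refl
  ... | Relation.Nullary.no ¬p = Data.Empty.⊥-elim (¬p refl)
    where import Data.Empty

Isomorphic : ∀ {n m} → Graph n → Graph m → Set
Isomorphic {n} {m} G H = Σ (Fin n ↔ Fin m) λ f →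
  ∀ u v → adj G u v ≡ adj H (Inverse.to f u) (Inverse.to f v)

-- Split graph structure: inC marks the clique part C; the rest is I.
IsSplit : ∀ {n} → Graph n → (Fin n → Bool) → Set
IsSplit G inC =
  (∀ u v → inC u ≡ true → inC v ≡ true → u ≢ v → Edge (adj G) u v) ×
  (∀ u v → inC u ≡ false → inC v ≡ false → adj G u v ≡ false)

IsBlockSplit : ∀ {n} → Graph n → (Fin n → Bool) → Set
IsBlockSplit G inC =
  IsSplit G inC × (∀ v → inC v ≡ false → deg (adj G) v ≤ 1)

sizeC : ∀ {n} → (Fin n → Bool) → ℕ
sizeC {n} inC = length (filterᵇ inC (allFin n))

Good : ∀ {n} → Graph n → (Fin n → Bool) → Fin n → Set
Good G inC u = inC u ≡ true × deg (adj G) u ≢ sizeC inC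

AtLeastTwoGood : ∀ {n} → Graph n → (Fin n → Bool) → Set
AtLeastTwoGood {n} G inC =
  Σ (Fin n) λ u → Σ (Fin n) λ v → u ≢ v × Good G inC u × Good G inC v

-- Every spanning tree of a block-split graph contains all pendant edges, so a clique vertex x has
-- tree degree c(x) + p(x), where c(x) counts its clique neighbours in the tree and p(x) its
-- pendant neighbours; and x is good exactly when p(x) ≠ 1.
-- Given a HIST of a graph that is not a tree, a cycle yields two clique vertices, so the tree
-- restricted to the clique has two leaves; a leaf has tree degree 1 + p(x) ≠ 2 and is good.
-- Conversely, let u ≠ v be good. If some vertex is bad, join the bad vertices into a path in
-- index order, hang v below its last and every other good vertex below its first vertex: each
-- bad vertex gets two clique neighbours, each good vertex one. If no vertex is bad, a star centred
-- at a clique vertex of degree ≠ 2 is a HIST, and if every clique vertex has degree 2 then G = K₃.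
module Submission where

open import Defs

open import Data.Bool using (Bool; true; false; not; _∧_; _∨_; if_then_else_)
open import Data.Bool.Properties using (∨-comm; ∧-zeroʳ; ∧-conicalˡ; ∧-conicalʳ) renaming (_≟_ to _≟ᵇ_)
open import Data.Empty using (⊥-elim)
open import Data.Fin using (Fin; toℕ) renaming (_≟_ to _≟ᶠ_)
open import Data.Fin.Properties using (any?; toℕ-injective; toℕ<n)
open import Data.List using (List; []; _∷_; _++_; length; filter; filterᵇ; allFin)
open import Data.List.Extrema.Nat using (argmin; argmax; argmin-all; argmax-all; f[argmin]≤f[xs]; f[xs]≤f[argmax])
open import Data.List.Membership.Propositional using (_∈_; _∉_)
open import Data.List.Membership.Propositional.Properties using (∈-allFin; ∈-∃++; ∈-filter⁺)
open import Data.List.Properties using (length-++; ++-assoc; length-tabulate)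
open import Data.List.Relation.Unary.All using (All; []; _∷_)
import Data.List.Relation.Unary.All as All
import Data.List.Relation.Unary.All.Properties as Allₚ
open import Data.List.Relation.Unary.AllPairs using ([]; _∷_)
import Data.List.Relation.Unary.AllPairs as AllPairs
open import Data.List.Relation.Unary.Any using (here; there)
open import Data.List.Relation.Unary.Linked using (Linked; []; [-]; _∷_)
import Data.List.Relation.Unary.Linked as Linked
open import Data.List.Relation.Unary.Unique.Propositional using (Unique)
open import Data.List.Relation.Unary.Unique.Propositional.Properties using (allFin⁺)
open import Data.Nat using (ℕ; zero; suc; _+_; _∸_; _≤_; _<_; z≤n; s≤s; _≟_; _<?_)
open import Data.Nat.Induction using (<-wellFounded)
open import Data.Nat.Properties
open import Data.Product using (Σ; _×_; _,_; proj₁; proj₂)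
open import Data.Sum using (_⊎_; inj₁; inj₂)
open import Data.Unit using (⊤; tt)
open import Function.Base using (case_of_)
open import Function.Bundles using (_⇔_; mk⇔; Equivalence)
open import Function.Construct.Identity using (↔-id)
open import Induction.WellFounded using (Acc; acc)
open import Relation.Binary.PropositionalEquality
open import Relation.Nullary using (¬_; Dec; yes; no; does; isYes; ¬?; _×-dec_)
open import Relation.Nullary.Decidable using (decidable-stable; dec-true; dec-false)
open import Relation.Unary using (Decidable)

module _ {A : Set} where

  count : (A → Bool) → List A → ℕ
  count P xs = length (filterᵇ P xs)

  count-cong : ∀ {P Q : A → Bool} → (∀ x → P x ≡ Q x) → ∀ xs → count P xs ≡ count Q xs
  count-cong P≗Q [] = refl
  count-cong {P} {Q} P≗Q (x ∷ xs) rewrite P≗Q x with Q x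
  ... | true  = cong suc (count-cong P≗Q xs)
  ... | false = count-cong P≗Q xs

  count-split : ∀ (P Q : A → Bool) xs →
    count P xs ≡ count (λ x → P x ∧ Q x) xs + count (λ x → P x ∧ not (Q x)) xs
  count-split P Q [] = refl
  count-split P Q (x ∷ xs) with P x | Q x
  ... | false | _     = count-split P Q xs
  ... | true  | true  = cong suc (count-split P Q xs)
  ... | true  | false = trans (cong suc (count-split P Q xs)) (sym (+-suc _ _))

  count-mono : ∀ {P Q : A → Bool} → (∀ x → P x ≡ true → Q x ≡ true) → ∀ xs → count P xs ≤ count Q xs
  count-mono P⊆Q [] = z≤n
  count-mono {P} {Q} P⊆Q (x ∷ xs) with P x in Px | Q x in Qx
  ... | false | false = count-mono P⊆Q xs
  ... | false | true  = m≤n⇒m≤1+n (count-mono P⊆Q xs)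
  ... | true  | true  = s≤s (count-mono P⊆Q xs)
  ... | true  | false with () ← trans (sym Qx) (P⊆Q x Px)

  count-<  : ∀ {P Q : A → Bool} {y} → (∀ x → P x ≡ true → Q x ≡ true) →
             ∀ xs → y ∈ xs → P y ≡ false → Q y ≡ true → count P xs < count Q xs
  count-< {P} {Q} P⊆Q (x ∷ xs) (here refl) Py Qy rewrite Py | Qy = s≤s (count-mono P⊆Q xs)
  count-< {P} {Q} P⊆Q (x ∷ xs) (there y∈xs) Py Qy with P x in Px | Q x in Qx
  ... | false | false = count-< P⊆Q xs y∈xs Py Qy
  ... | false | true  = m≤n⇒m≤1+n (count-< P⊆Q xs y∈xs Py Qy)
  ... | true  | true  = s≤s (count-< P⊆Q xs y∈xs Py Qy)
  ... | true  | false with () ← trans (sym Qx) (P⊆Q x Px)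

  count-pos : ∀ {P : A → Bool} {y} xs → y ∈ xs → P y ≡ true → 1 ≤ count P xs
  count-pos {P} (x ∷ xs) y∈ Py with P x in Px
  ... | true = s≤s z≤n
  count-pos (x ∷ xs) (here refl) Py | false with () ← trans (sym Py) Px
  count-pos (x ∷ xs) (there y∈) Py | false = count-pos xs y∈ Py

  count-two : ∀ {P : A → Bool} {y z} xs → Unique xs → y ∈ xs → z ∈ xs → y ≢ z →
              P y ≡ true → P z ≡ true → 2 ≤ count P xs
  count-two (x ∷ xs) _ (here refl) (here refl) y≢z _ _ = ⊥-elim (y≢z refl)
  count-two (x ∷ xs) _ (here refl) (there z∈) _ Py Pz rewrite Py = s≤s (count-pos xs z∈ Pz)
  count-two (x ∷ xs) _ (there y∈) (here refl) _ Py Pz rewrite Pz = s≤s (count-pos xs y∈ Py)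
  count-two {P} (x ∷ xs) (_ ∷ u) (there y∈) (there z∈) y≢z Py Pz with P x
  ... | true  = m≤n⇒m≤1+n (count-two xs u y∈ z∈ y≢z Py Pz)
  ... | false = count-two xs u y∈ z∈ y≢z Py Pz

  count-all : ∀ {P : A → Bool} → (∀ x → P x ≡ true) → ∀ xs → count P xs ≡ length xs
  count-all all-P []       = refl
  count-all all-P (x ∷ xs) rewrite all-P x = cong suc (count-all all-P xs)

  count-zero : ∀ {P : A → Bool} xs → All (λ x → P x ≡ false) xs → count P xs ≡ 0
  count-zero [] [] = refl
  count-zero (x ∷ xs) (Px ∷ ps) rewrite Px = count-zero xs ps

  count-one : ∀ {P : A → Bool} {y} xs → Unique xs → y ∈ xs → P y ≡ true →
              (∀ x → P x ≡ true → x ≡ y) → count P xs ≡ 1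
  count-one {P} (x ∷ xs) (x∉xs ∷ _) (here refl) Py only rewrite Py =
    cong suc (count-zero xs (All.map others x∉xs))
    where
    others : ∀ {w} → x ≢ w → P w ≡ false
    others {w} x≢w with P w in Pw
    ... | true  = ⊥-elim (x≢w (sym (only w Pw)))
    ... | false = refl
  count-one {P} (x ∷ xs) (x∉xs ∷ u) (there y∈) Py only with P x in Px
  ... | true  = ⊥-elim (All.lookup x∉xs (subst (_∈ xs) (sym (only x Px)) y∈) refl)
  ... | false = count-one xs u y∈ Py only

_==_ : ∀ {n} → Fin n → Fin n → Bool
a == b = isYes (a ≟ᶠ b)

==-refl : ∀ {n} (a : Fin n) → (a == a) ≡ true
==-refl a with a ≟ᶠ a
... | yes _  = refl
... | no a≢a = ⊥-elim (a≢a refl)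

==⇒≡ : ∀ {n} {a b : Fin n} → (a == b) ≡ true → a ≡ b
==⇒≡ {a = a} {b} _ with a ≟ᶠ b
... | yes a≡b = a≡b

≢⇒==false : ∀ {n} {a b : Fin n} → a ≢ b → (a == b) ≡ false
≢⇒==false {a = a} {b} a≢b with a ≟ᶠ b
... | yes a≡b = ⊥-elim (a≢b a≡b)
... | no _    = refl

∧-congʳ-when : ∀ {x y} b → (b ≡ true → x ≡ y) → x ∧ b ≡ y ∧ b
∧-congʳ-when false _   = trans (∧-zeroʳ _) (sym (∧-zeroʳ _))
∧-congʳ-when true  x≡y = cong (_∧ true) (x≡y refl)

module _ {n p} {P : Fin n → Set p} (P? : Decidable P) where

  private
    candidates : List (Fin n)
    candidates = filter P? (allFin n)

    candidate : ∀ {y} → P y → y ∈ candidates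
    candidate {y} py = ∈-filter⁺ P? (∈-allFin y) py

  least : Fin n → Fin n
  least w = argmin toℕ w candidates

  least-satisfies : ∀ {w} → P w → P (least w)
  least-satisfies pw = argmin-all toℕ pw (Allₚ.all-filter P? (allFin n))

  least-≤ : ∀ {w y} → P y → toℕ (least w) ≤ toℕ y
  least-≤ {w} py = All.lookup (f[argmin]≤f[xs] w candidates) (candidate py)

  greatest : Fin n → Fin n
  greatest w = argmax toℕ w candidates

  greatest-satisfies : ∀ {w} → P w → P (greatest w)
  greatest-satisfies pw = argmax-all toℕ pw (Allₚ.all-filter P? (allFin n))

  greatest-≥ : ∀ {w y} → P y → toℕ y ≤ toℕ (greatest w)
  greatest-≥ {w} py = All.lookup (f[xs]≤f[argmax] w candidates) (candidate py)

module _ {n} {E : Fin n → Fin n → Bool} where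

  walk-++ : ∀ {a b c} → Walk E a b → Walk E b c → Walk E a c
  walk-++ here       q = q
  walk-++ (step e p) q = step e (walk-++ p q)

  walk-reverse : (∀ u v → E u v ≡ E v u) → ∀ {a b} → Walk E a b → Walk E b a
  walk-reverse E-sym here = here
  walk-reverse E-sym (step {u} {w} e p) = walk-++ (walk-reverse E-sym p) (step (trans (E-sym w u) e) here)

  firstStep : ∀ {a b} → Walk E a b → Fin n
  firstStep {a} here           = a
  firstStep (step {w = w} _ _) = w

  firstStep-adjacent : ∀ {a b} → a ≢ b → (p : Walk E a b) → Edge E a (firstStep p)
  firstStep-adjacent a≢a here = ⊥-elim (a≢a refl)
  firstStep-adjacent _ (step e _) = e

module RootedTree {n} (G : Graph n) (par : Fin n → Fin n) (h : Fin n → ℕ) (r : Fin n)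
  (h-par : ∀ v → v ≢ r → h (par v) < h v)
  (adj-par : ∀ v → v ≢ r → Edge (adj G) v (par v)) where

  Up : Fin n → Fin n → Set
  Up u v = u ≢ r × par u ≡ v

  parentEdge : Fin n → Fin n → Bool
  parentEdge u v = not (u == r) ∧ (par u == v)

  T : Fin n → Fin n → Bool
  T u v = parentEdge u v ∨ parentEdge v u

  T-sym : ∀ u v → T u v ≡ T v u
  T-sym u v = ∨-comm (parentEdge u v) (parentEdge v u)

  parentEdge⇒Up : ∀ {u v} → parentEdge u v ≡ true → Up u v
  parentEdge⇒Up {u} {v} e with u ≟ᶠ r | par u ≟ᶠ v
  ... | no u≢r | yes pu≡v = u≢r , pu≡v

  Up⇒parentEdge : ∀ {u v} → Up u v → parentEdge u v ≡ true
  Up⇒parentEdge {u} (u≢r , refl) rewrite ≢⇒==false u≢r | ==-refl (par u) = refl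

  T⇒Up : ∀ {u v} → Edge T u v → Up u v ⊎ Up v u
  T⇒Up {u} {v} e with parentEdge u v in uv | parentEdge v u in vu
  ... | true  | _    = inj₁ (parentEdge⇒Up uv)
  ... | false | true = inj₂ (parentEdge⇒Up vu)

  Up⇒T : ∀ {u v} → Up u v → Edge T u v
  Up⇒T up rewrite Up⇒parentEdge up = refl

  Up⇒T˘ : ∀ {u v} → Up v u → Edge T u v
  Up⇒T˘ {u} {v} up = trans (T-sym u v) (Up⇒T up)

  Up-h : ∀ {u v} → Up u v → h v < h u
  Up-h {u} (u≢r , refl) = h-par u u≢r

  T⊆G : ∀ u v → Edge T u v → Edge (adj G) u v
  T⊆G u v e with T⇒Up {u} {v} e
  ... | inj₁ (u≢r , refl) = adj-par u u≢r
  ... | inj₂ (v≢r , refl) = trans (adj-sym G (par v) v) (adj-par v v≢r)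

  walk-to-root : ∀ v → Acc _<_ (h v) → Walk T v r
  walk-to-root v (acc rec) with v ≟ᶠ r
  ... | yes refl = here
  ... | no v≢r   = step (Up⇒T (v≢r , refl)) (walk-to-root (par v) (rec (h-par v v≢r)))

  T-connected : Connected T
  T-connected u v =
    walk-++ (walk-to-root u (<-wellFounded _)) (walk-reverse T-sym (walk-to-root v (<-wellFounded _)))

  NoBacktrack : List (Fin n) → Set
  NoBacktrack (a ∷ b ∷ c ∷ rest) = a ≢ c × NoBacktrack (b ∷ c ∷ rest)
  NoBacktrack _                  = ⊤

  lastOf : Fin n → List (Fin n) → Fin n
  lastOf a []       = a
  lastOf a (b ∷ bs) = lastOf b bs

  LastPair : (Fin n → Fin n → Set) → Fin n → Fin n → List (Fin n) → Set
  LastPair R a b []         = R a b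
  LastPair R a b (c ∷ rest) = LastPair R b c rest

  -- Without backtracking, a path can never step up again once it has stepped down.
  descending : ∀ a b rest → Linked (Edge T) (a ∷ b ∷ rest) → NoBacktrack (a ∷ b ∷ rest) →
               Up b a → h a < h (lastOf b rest)
  descending a b []         _       _          ba = Up-h ba
  descending a b (c ∷ rest) (_ ∷ l) (a≢c , nb) ba with T⇒Up (Linked.head l)
  ... | inj₁ bc = ⊥-elim (a≢c (trans (sym (proj₂ ba)) (proj₂ bc)))
  ... | inj₂ cb = <-trans (Up-h ba) (descending b c rest l nb cb)

  ascending : ∀ a b rest → Linked (Edge T) (a ∷ b ∷ rest) → NoBacktrack (a ∷ b ∷ rest) →
              LastPair Up a b rest → Up a b × h (lastOf b rest) < h a
  ascending a b []         _       _          ab   = ab , Up-h ab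
  ascending a b (c ∷ rest) (e ∷ l) (a≢c , nb) last with ascending b c rest l nb last
  ... | bc , hc<hb with T⇒Up e
  ...   | inj₁ ab = ab , <-trans hc<hb (Up-h ab)
  ...   | inj₂ ba = ⊥-elim (a≢c (trans (sym (proj₂ ba)) (proj₂ bc)))

  last-direction : ∀ a b rest → Linked (Edge T) (a ∷ b ∷ rest) →
                   LastPair Up a b rest ⊎ LastPair (λ x y → Up y x) a b rest
  last-direction a b []         (e ∷ _) = T⇒Up e
  last-direction a b (c ∷ rest) (_ ∷ l) = last-direction b c rest l

  LastPair-snoc : ∀ {R} a b ws z → LastPair R a b (ws ++ z ∷ []) → R (lastOf b ws) z
  LastPair-snoc a b []       z last = last
  LastPair-snoc a b (c ∷ ws) z last = LastPair-snoc b c ws z last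

  lastOf-snoc : ∀ b ws z → lastOf b (ws ++ z ∷ []) ≡ z
  lastOf-snoc b []       z = refl
  lastOf-snoc b (c ∷ ws) z = lastOf-snoc c ws z

  lastOf-∈ : ∀ c ws → lastOf c ws ∈ c ∷ ws
  lastOf-∈ c []       = here refl
  lastOf-∈ c (d ∷ ws) = there (lastOf-∈ d ws)

  noBacktrack-snoc : ∀ ys x → Unique ys → All (x ≢_) ys → NoBacktrack (ys ++ x ∷ [])
  noBacktrack-snoc []               x _ _   = tt
  noBacktrack-snoc (a ∷ [])         x _ _   = tt
  noBacktrack-snoc (a ∷ b ∷ [])     x _ (x≢a ∷ _) = (λ a≡x → x≢a (sym a≡x)) , tt
  noBacktrack-snoc (a ∷ b ∷ c ∷ ys) x ((_ ∷ a≢c ∷ _) ∷ u) (_ ∷ x∉) =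
    a≢c , noBacktrack-snoc (b ∷ c ∷ ys) x u x∉

  cycle-noBacktrack : ∀ x x₁ x₂ xs → Unique (x ∷ x₁ ∷ x₂ ∷ xs) →
                      NoBacktrack (x ∷ x₁ ∷ x₂ ∷ xs ++ x ∷ [])
  cycle-noBacktrack x x₁ x₂ xs (x∉@(_ ∷ x≢x₂ ∷ _) ∷ u₁) =
    x≢x₂ , noBacktrack-snoc (x₁ ∷ x₂ ∷ xs) x u₁ x∉

  -- A cycle can neither keep descending nor keep ascending, so both of its edges at x go up to par x.
  acyclic : ¬ HasCycle T
  acyclic (x , []              , ()       , _)
  acyclic (x , _ ∷ []          , s≤s ()   , _)
  acyclic (x , x₁ ∷ x₂ ∷ xs , _ , u@(_ ∷ (x₁∉ ∷ _)) , link@(e ∷ _))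
    with T⇒Up e | last-direction x x₁ (x₂ ∷ xs ++ x ∷ []) link
  ... | inj₂ x₁x | _ =
    <-irrefl (cong h (sym (lastOf-snoc x₁ (x₂ ∷ xs) x)))
             (descending x x₁ (x₂ ∷ xs ++ x ∷ []) link nb x₁x)
    where nb = cycle-noBacktrack x x₁ x₂ xs u
  ... | inj₁ _ | inj₁ lastUp =
    <-irrefl (cong h (lastOf-snoc x₁ (x₂ ∷ xs) x))
             (proj₂ (ascending x x₁ (x₂ ∷ xs ++ x ∷ []) link nb lastUp))
    where nb = cycle-noBacktrack x x₁ x₂ xs u
  ... | inj₁ (_ , px≡x₁) | inj₂ lastDown =
    All.lookup x₁∉ (lastOf-∈ x₂ xs)
               (trans (sym px≡x₁) (proj₂ (LastPair-snoc x x₁ (x₂ ∷ xs) x lastDown)))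

  spanning : IsSpanningTree G T
  spanning = T-sym , T⊆G , T-connected , acyclic

unique-prefix : ∀ {A : Set} (as : List A) {z bs} → Unique (as ++ z ∷ bs) → Unique (as ++ z ∷ [])
unique-prefix []       (_ ∷ _)    = [] ∷ []
unique-prefix (a ∷ as) (a∉ ∷ u) =
  Allₚ.++⁺ (Allₚ.++⁻ˡ as a∉) (All.head (Allₚ.++⁻ʳ as a∉) ∷ []) ∷ unique-prefix as u

linked-prefix : ∀ {A : Set} {R : A → A → Set} (as : List A) {z w bs} →
                Linked R (as ++ z ∷ bs) → R z w → Linked R (as ++ z ∷ w ∷ [])
linked-prefix []           _       r = r ∷ [-]
linked-prefix (a ∷ [])     (r′ ∷ l) r = r′ ∷ linked-prefix [] l r
linked-prefix (a ∷ b ∷ as) (r′ ∷ l) r = r′ ∷ linked-prefix (b ∷ as) l r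

module InducedLeaves {n} (E : Fin n → Fin n → Bool) (E-sym : ∀ u v → E u v ≡ E v u)
  (E-irr : ∀ v → E v v ≡ false) (Q : Fin n → Bool) where

  open import Data.List.Membership.DecPropositional (_≟ᶠ_ {n}) using (_∈?_)

  IsQPath : List (Fin n) → Set
  IsQPath ps = Unique ps × Linked (Edge E) ps × All (λ w → Q w ≡ true) ps

  record QLeaf (x : Fin n) : Set where
    field
      inQ           : Q x ≡ true
      neighbour     : Fin n
      neighbour-inQ : Q neighbour ≡ true
      adjacent      : Edge E x neighbour
      unique        : ∀ z → Edge E x z → Q z ≡ true → z ≡ neighbour

  record MaximalPath (y : Fin n) : Set where
    field
      first second : Fin n
      rest         : List (Fin n)
      isQPath      : IsQPath (first ∷ second ∷ rest)
      maximal      : ∀ z → Edge E first z → Q z ≡ true → z ∈ first ∷ second ∷ rest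
      contains     : y ∈ second ∷ rest

  unvisited : List (Fin n) → ℕ
  unvisited ps = count (λ w → not (isYes (w ∈? ps))) (allFin n)

  unvisited-< : ∀ z ps → z ∉ ps → unvisited (z ∷ ps) < unvisited ps
  unvisited-< z ps z∉ = count-< shrinks (allFin n) (∈-allFin z) z-visited z-unvisited
    where
    shrinks : ∀ w → not (isYes (w ∈? z ∷ ps)) ≡ true → not (isYes (w ∈? ps)) ≡ true
    shrinks w _ with w ∈? ps | w ∈? z ∷ ps
    ... | no _   | _     = refl
    ... | yes w∈ | no w∉ = ⊥-elim (w∉ (there w∈))
    z-visited : not (isYes (z ∈? z ∷ ps)) ≡ false
    z-visited with z ∈? z ∷ ps
    ... | yes _ = refl
    ... | no z∉′ = ⊥-elim (z∉′ (here refl))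
    z-unvisited : not (isYes (z ∈? ps)) ≡ true
    z-unvisited with z ∈? ps
    ... | yes z∈ = ⊥-elim (z∉ z∈)
    ... | no _   = refl

  extend : ∀ {y} x y′ rs → IsQPath (x ∷ y′ ∷ rs) → y ∈ y′ ∷ rs →
           Acc _<_ (unvisited (x ∷ y′ ∷ rs)) → MaximalPath y
  extend x y′ rs p@(u , l , qs) y∈ (acc rec)
    with any? (λ z → (E x z ≟ᵇ true) ×-dec (Q z ≟ᵇ true) ×-dec ¬? (z ∈? x ∷ y′ ∷ rs))
  ... | yes (z , exz , qz , z∉) =
    extend z x (y′ ∷ rs) (Allₚ.¬Any⇒All¬ _ z∉ ∷ u , trans (E-sym z x) exz ∷ l , qz ∷ qs) (there y∈)
           (rec (unvisited-< z _ z∉))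
  ... | no none = record { isQPath = p ; maximal = maximal ; contains = y∈ }
    where
    maximal : ∀ z → Edge E x z → Q z ≡ true → z ∈ x ∷ y′ ∷ rs
    maximal z exz qz with z ∈? x ∷ y′ ∷ rs
    ... | yes z∈ = z∈
    ... | no z∉  = ⊥-elim (none (z , exz , qz , z∉))

  maximal-first-is-leaf : ¬ HasCycle E → ∀ {y} (mp : MaximalPath y) → QLeaf (MaximalPath.first mp)
  maximal-first-is-leaf acyclic record { first = x ; second = y′ ; rest = rs
                                       ; isQPath = u , l@(exy ∷ _) , qx ∷ qy ∷ _ ; maximal = maximal } =
    record { inQ = qx ; neighbour-inQ = qy ; adjacent = exy ; unique = only-neighbour }
    where
    only-neighbour : ∀ z → Edge E x z → Q z ≡ true → z ≡ y′
    only-neighbour z exz qz with maximal z exz qz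
    ... | here refl with () ← trans (sym (E-irr x)) exz
    ... | there (here refl) = refl
    ... | there (there z∈) with ∈-∃++ z∈
    ...   | as , bs , refl =
      ⊥-elim (acyclic (x , y′ ∷ as ++ z ∷ [] , long , unique-prefix (x ∷ y′ ∷ as) u , closed))
      where
      long : 2 ≤ length (y′ ∷ as ++ z ∷ [])
      long rewrite length-++ as {z ∷ []} | +-comm (length as) 1 = s≤s (s≤s z≤n)
      closed : Linked (Edge E) (x ∷ (y′ ∷ as ++ z ∷ []) ++ x ∷ [])
      closed = subst (λ q → Linked (Edge E) (x ∷ y′ ∷ q)) (sym (++-assoc as (z ∷ []) (x ∷ [])))
                 (linked-prefix (x ∷ y′ ∷ as) l (trans (E-sym z x) exz))

  edge-path : ∀ {a b} → Edge E a b → Q a ≡ true → Q b ≡ true → IsQPath (a ∷ b ∷ [])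
  edge-path {a} eab qa qb = (a≢b ∷ []) ∷ [] ∷ [] , eab ∷ [-] , qa ∷ qb ∷ []
    where
    a≢b : a ≢ _
    a≢b refl with () ← trans (sym (E-irr a)) eab

  two-leaves : ¬ HasCycle E → ∀ {c d} → Edge E c d → Q c ≡ true → Q d ≡ true →
               Σ (Fin n) λ x₁ → Σ (Fin n) λ x₂ → x₁ ≢ x₂ × QLeaf x₁ × QLeaf x₂
  two-leaves acyclic {c} {d} ecd qc qd =
    first M₁ , first M₂ , x₁≢x₂ , leaf₁ , maximal-first-is-leaf acyclic M₂
    where
    open MaximalPath
    open QLeaf
    M₁ = extend c d [] (edge-path ecd qc qd) (here refl) (<-wellFounded _)
    leaf₁ = maximal-first-is-leaf acyclic M₁
    x₁ = first M₁
    y₁ = neighbour leaf₁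
    M₂ : MaximalPath x₁
    M₂ = extend y₁ x₁ [] (edge-path (trans (E-sym y₁ x₁) (adjacent leaf₁)) (neighbour-inQ leaf₁) (inQ leaf₁))
                (here refl) (<-wellFounded _)
    x₁≢x₂ : x₁ ≢ first M₂
    x₁≢x₂ x₁≡x₂ = All.lookup (AllPairs.head (proj₁ (isQPath M₂))) (contains M₂) (sym x₁≡x₂)

isomorphic-K₃ : ∀ {n} (G : Graph n) → n ≡ 3 → (∀ a b → adj G a b ≡ not (a == b)) → Isomorphic G (K 3)
isomorphic-K₃ G refl adjacency = ↔-id _ , adjacency

module BlockSplit {n} (G : Graph n) (inC : Fin n → Bool) (block-split : IsBlockSplit G inC) where

  A : Fin n → Fin n → Bool
  A = adj G

  V : List (Fin n)
  V = allFin n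

  clique : ∀ a b → inC a ≡ true → inC b ≡ true → a ≢ b → Edge A a b
  clique = proj₁ (proj₁ block-split)

  independent : ∀ a b → inC a ≡ false → inC b ≡ false → A a b ≡ false
  independent = proj₂ (proj₁ block-split)

  A-≢ : ∀ {a b} → Edge A a b → a ≢ b
  A-≢ {a} e refl with () ← trans (sym (adj-irr G a)) e

  pendant-neighbour-unique : ∀ {y a b} → inC y ≡ false → Edge A y a → Edge A y b → a ≡ b
  pendant-neighbour-unique {y} {a} {b} iy ya yb with a ≟ᶠ b
  ... | yes a≡b = a≡b
  ... | no a≢b  = ⊥-elim (<⇒≱ (count-two V (allFin⁺ n) (∈-allFin a) (∈-allFin b) a≢b ya yb)
                              (proj₂ block-split y iy))

  two-neighbours⇒inC : ∀ {y a b} → Edge A y a → Edge A y b → a ≢ b → inC y ≡ true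
  two-neighbours⇒inC {y} ya yb a≢b with inC y in iy
  ... | true  = refl
  ... | false = ⊥-elim (a≢b (pendant-neighbour-unique iy ya yb))

  pendant-neighbour-inC : ∀ {y a} → inC y ≡ false → Edge A y a → inC a ≡ true
  pendant-neighbour-inC {y} {a} iy ya with inC a in ia
  ... | true  = refl
  ... | false with () ← trans (sym (independent y a iy ia)) ya

  cycle-clique-pair : HasCycle A → Σ (Fin n) λ a → Σ (Fin n) λ b → inC a ≡ true × inC b ≡ true × a ≢ b
  cycle-clique-pair (x , []              , ()     , _)
  cycle-clique-pair (x , _ ∷ []          , s≤s () , _)
  cycle-clique-pair
    (x , x₁ ∷ x₂ ∷ xs , _ , (x≢x₁ ∷ x≢x₂ ∷ _) ∷ (x₁∉ @ (x₁≢x₂ ∷ _)) ∷ _ , e₀₁ ∷ e₁₂ ∷ link) =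
    x₁ , x₂ , two-neighbours⇒inC (trans (adj-sym G x₁ x) e₀₁) e₁₂ x≢x₂ , inC-x₂ xs link x₁∉ , x₁≢x₂
    where
    e₂₁ = trans (adj-sym G x₂ x₁) e₁₂
    inC-x₂ : ∀ ys → Linked (Edge A) (x₂ ∷ ys ++ x ∷ []) → All (x₁ ≢_) (x₂ ∷ ys) → inC x₂ ≡ true
    inC-x₂ []      (e₂ ∷ _) _               = two-neighbours⇒inC e₂₁ e₂ (λ x₁≡x → x≢x₁ (sym x₁≡x))
    inC-x₂ (_ ∷ _) (e₂ ∷ _) (_ ∷ x₁≢x₃ ∷ _) = two-neighbours⇒inC e₂₁ e₂ x₁≢x₃

  pendants : Fin n → ℕ
  pendants x = count (λ w → A x w ∧ not (inC w)) V

  cliqueDegree : (Fin n → Fin n → Bool) → Fin n → ℕ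
  cliqueDegree E x = count (λ w → E x w ∧ inC w) V

  deg-G : ∀ x → deg A x ≡ cliqueDegree A x + pendants x
  deg-G x = count-split (A x) inC V

  sizeC≡suc-cliqueDegree : ∀ {x} → inC x ≡ true → sizeC inC ≡ suc (cliqueDegree A x)
  sizeC≡suc-cliqueDegree {x} ix =
    trans (count-split inC (x ==_) V) (cong₂ _+_ just-x (count-cong others V))
    where
    just-x : count (λ w → inC w ∧ (x == w)) V ≡ 1
    just-x = count-one V (allFin⁺ n) (∈-allFin x) (cong₂ _∧_ ix (==-refl x)) λ w e →
               sym (==⇒≡ (∧-conicalʳ (inC w) (x == w) e))
    others : ∀ w → inC w ∧ not (x == w) ≡ A x w ∧ inC w
    others w with inC w in iw | x ≟ᶠ w
    ... | false | _        = sym (∧-zeroʳ (A x w))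
    ... | true  | yes refl = sym (cong (_∧ true) (adj-irr G x))
    ... | true  | no x≢w   = sym (cong (_∧ true) (clique x w ix iw x≢w))

  deg≡sizeC⇔pendants≡1 : ∀ {x} → inC x ≡ true → deg A x ≡ sizeC inC ⇔ pendants x ≡ 1
  deg≡sizeC⇔pendants≡1 {x} ix = mk⇔
    (λ e → +-cancelˡ-≡ (cliqueDegree A x) _ _ (trans (sym (deg-G x)) (trans e size)))
    (λ e → trans (deg-G x) (trans (cong (cliqueDegree A x +_) e) (sym size)))
    where
    size : sizeC inC ≡ cliqueDegree A x + 1
    size = trans (sizeC≡suc-cliqueDegree ix) (+-comm 1 _)

  Good⇒pendants≢1 : ∀ {x} → Good G inC x → pendants x ≢ 1
  Good⇒pendants≢1 (ix , deg≢size) e = deg≢size (Equivalence.from (deg≡sizeC⇔pendants≡1 ix) e)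

  pendants≢1⇒Good : ∀ {x} → inC x ≡ true → pendants x ≢ 1 → Good G inC x
  pendants≢1⇒Good ix p≢1 = ix , λ e → p≢1 (Equivalence.to (deg≡sizeC⇔pendants≡1 ix) e)

  module SpanningTree (T : Fin n → Fin n → Bool) (spanning : IsSpanningTree G T) where

    T-sym : ∀ u v → T u v ≡ T v u
    T-sym = proj₁ spanning

    T⊆A : ∀ u v → Edge T u v → Edge A u v
    T⊆A = proj₁ (proj₂ spanning)

    T-connected : Connected T
    T-connected = proj₁ (proj₂ (proj₂ spanning))

    T-acyclic : ¬ HasCycle T
    T-acyclic = proj₂ (proj₂ (proj₂ spanning))

    pendant-edge-in-tree : ∀ {x w} → inC w ≡ false → Edge A x w → Edge T x w
    pendant-edge-in-tree {x} {w} iw xw =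
      trans (T-sym x w) (subst (Edge T w) (pendant-neighbour-unique iw (T⊆A w _ first) wx) first)
      where
      wx = trans (adj-sym G w x) xw
      first = firstStep-adjacent (A-≢ wx) (T-connected w x)

    deg-tree : ∀ x → deg T x ≡ cliqueDegree T x + pendants x
    deg-tree x = trans (count-split (T x) inC V) (cong (cliqueDegree T x +_) (count-cong same-pendants V))
      where
      same-pendants : ∀ w → T x w ∧ not (inC w) ≡ A x w ∧ not (inC w)
      same-pendants w with inC w in iw | A x w in xw
      ... | true  | _     = trans (∧-zeroʳ _) (sym (∧-zeroʳ _))
      ... | false | true  = cong (_∧ true) (pendant-edge-in-tree iw xw)
      ... | false | false with T x w in tw
      ...   | false = refl
      ...   | true with () ← trans (sym xw) (T⊆A x w tw)

    isHIST : (∀ x → inC x ≡ true → cliqueDegree T x + pendants x ≢ 2) → IsHIST G T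
    isHIST clique-ok = spanning , deg≢2
      where
      deg≢2 : ∀ x → deg T x ≢ 2
      deg≢2 x with inC x in ix
      ... | true  = λ e → clique-ok x ix (trans (sym (deg-tree x)) e)
      ... | false = λ e → <⇒≱ (≤-reflexive (sym e))
                      (≤-trans (count-mono (T⊆A x) V) (proj₂ block-split x ix))

    clique-edge : ∀ {a b} → Walk T a b → inC a ≡ true → inC b ≡ true → a ≢ b →
                  Σ (Fin n) λ c → Σ (Fin n) λ d → Edge T c d × inC c ≡ true × inC d ≡ true
    clique-edge here ia ib a≢a = ⊥-elim (a≢a refl)
    clique-edge {a} (step {w = w} aw p) ia ib a≢b with inC w in iw
    ... | true = a , w , aw , ia , iw
    clique-edge (step _ here) ia ib _ | false with () ← trans (sym iw) ib
    clique-edge {a} (step {w = w} aw (step {w = a′} wa′ p)) ia ib a≢b | false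
      with pendant-neighbour-unique iw (T⊆A w a′ wa′) (trans (adj-sym G w a) (T⊆A a w aw))
    ... | refl = clique-edge p ia ib a≢b

    T-irr : ∀ v → T v v ≡ false
    T-irr v with T v v in tv
    ... | false = refl
    ... | true  = ⊥-elim (A-≢ (T⊆A v v tv) refl)

    open InducedLeaves T T-sym T-irr inC using (QLeaf; two-leaves) public

    cliqueLeaf⇒Good : (∀ v → deg T v ≢ 2) → ∀ {x} → QLeaf x → Good G inC x
    cliqueLeaf⇒Good deg≢2 {x} leaf = pendants≢1⇒Good inQ λ p≡1 →
      deg≢2 x (trans (deg-tree x) (cong₂ _+_ one-clique-neighbour p≡1))
      where
      open QLeaf leaf
      one-clique-neighbour : cliqueDegree T x ≡ 1
      one-clique-neighbour = count-one V (allFin⁺ n) (∈-allFin neighbour) (cong₂ _∧_ adjacent neighbour-inQ)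
        λ z e → unique z (∧-conicalˡ (T x z) (inC z) e) (∧-conicalʳ (T x z) (inC z) e)

  twoGood? : Dec (AtLeastTwoGood G inC)
  twoGood? = any? λ u → any? λ v → ¬? (u ≟ᶠ v) ×-dec good? u ×-dec good? v
    where
    good? : ∀ u → Dec (Good G inC u)
    good? u = (inC u ≟ᵇ true) ×-dec ¬? (deg A u ≟ sizeC inC)

  necessity : Connected A → ¬ IsTree A → HasHIST G → AtLeastTwoGood G inC
  necessity conn not-tree (T , spanning , deg≢2) =
    decidable-stable twoGood? λ ¬two → not-tree (conn , λ cycle → ¬two (from-cycle cycle))
    where
    open SpanningTree T spanning
    from-cycle : HasCycle A → AtLeastTwoGood G inC
    from-cycle cycle =
      let a , b , ia , ib , a≢b           = cycle-clique-pair cycle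
          c , d , cd , ic , id            = clique-edge (T-connected a b) ia ib a≢b
          x₁ , x₂ , x₁≢x₂ , leaf₁ , leaf₂ = two-leaves T-acyclic cd ic id
      in x₁ , x₂ , x₁≢x₂ , cliqueLeaf⇒Good deg≢2 {x₁} leaf₁ , cliqueLeaf⇒Good deg≢2 {x₂} leaf₂

  module Attachment (conn : Connected A) (c₀ : Fin n) (ic₀ : inC c₀ ≡ true) where

    attachment : Fin n → Fin n
    attachment w = firstStep (conn w c₀)

    attachment-adjacent : ∀ {w} → inC w ≡ false → Edge A w (attachment w)
    attachment-adjacent {w} iw = firstStep-adjacent (λ { refl → case trans (sym iw) ic₀ of λ () }) (conn w c₀)

    attachment-inC : ∀ {w} → inC w ≡ false → inC (attachment w) ≡ true
    attachment-inC iw = pendant-neighbour-inC iw (attachment-adjacent iw)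

    module CliqueTree (par : Fin n → Fin n) (h : Fin n → ℕ) (r : Fin n) (H : ℕ)
      (par-inC : ∀ x → inC x ≡ true → x ≢ r → inC (par x) ≡ true)
      (h-par   : ∀ x → inC x ≡ true → x ≢ r → h (par x) < h x)
      (h-≤     : ∀ x → inC x ≡ true → h x ≤ H) where

      par⁺ : Fin n → Fin n
      par⁺ x = if inC x then par x else attachment x

      h⁺ : Fin n → ℕ
      h⁺ x = if inC x then h x else suc H

      par⁺-inC : ∀ {x} → inC x ≡ true → par⁺ x ≡ par x
      par⁺-inC ix rewrite ix = refl

      h⁺-inC : ∀ {x} → inC x ≡ true → h⁺ x ≡ h x
      h⁺-inC ix rewrite ix = refl

      h⁺-par⁺ : ∀ x → x ≢ r → h⁺ (par⁺ x) < h⁺ x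
      h⁺-par⁺ x x≢r with inC x in ix
      ... | true  rewrite h⁺-inC (par-inC x ix x≢r) = h-par x ix x≢r
      ... | false rewrite h⁺-inC (attachment-inC ix) = s≤s (h-≤ _ (attachment-inC ix))

      adj-par⁺ : ∀ x → x ≢ r → Edge A x (par⁺ x)
      adj-par⁺ x x≢r with inC x in ix
      ... | true  = clique x (par x) ix (par-inC x ix x≢r) λ x≡px →
                      <-irrefl (cong h (sym x≡px)) (h-par x ix x≢r)
      ... | false = attachment-adjacent ix

      open RootedTree G par⁺ h⁺ r h⁺-par⁺ adj-par⁺ using (T; T⇒Up; Up⇒T; Up⇒T˘; spanning) public
      open SpanningTree T spanning using (isHIST; T-irr) public

      T-parent : ∀ {x} → inC x ≡ true → x ≢ r → Edge T x (par x)
      T-parent ix x≢r = Up⇒T (x≢r , par⁺-inC ix)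

      T-child : ∀ {x y} → inC y ≡ true → y ≢ r → par y ≡ x → Edge T x y
      T-child iy y≢r py≡x = Up⇒T˘ (y≢r , trans (par⁺-inC iy) py≡x)

      cliqueDegree-leaf : ∀ {x} → inC x ≡ true → x ≢ r →
                          (∀ y → inC y ≡ true → y ≢ r → par y ≢ x) → cliqueDegree T x ≡ 1
      cliqueDegree-leaf {x} ix x≢r childless =
        count-one V (allFin⁺ n) (∈-allFin (par x)) (cong₂ _∧_ (T-parent ix x≢r) (par-inC x ix x≢r)) only-parent
        where
        only-parent : ∀ y → T x y ∧ inC y ≡ true → y ≡ par x
        only-parent y e with T⇒Up (∧-conicalˡ (T x y) (inC y) e)
        ... | inj₁ (_ , px≡y)   = trans (sym px≡y) (par⁺-inC ix)
        ... | inj₂ (y≢r , py≡x) = ⊥-elim (childless y iy y≢r (trans (sym (par⁺-inC iy)) py≡x))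
          where iy = ∧-conicalʳ (T x y) (inC y) e

      cliqueDegree-two : ∀ {x y z} → Edge T x y → inC y ≡ true → Edge T x z → inC z ≡ true → y ≢ z →
                         2 ≤ cliqueDegree T x
      cliqueDegree-two xy iy xz iz y≢z =
        count-two V (allFin⁺ n) (∈-allFin _) (∈-allFin _) y≢z (cong₂ _∧_ xy iy) (cong₂ _∧_ xz iz)

      hist : (∀ x → inC x ≡ true → cliqueDegree T x + pendants x ≢ 2) → HasHIST G
      hist clique-ok = T , isHIST clique-ok

    module Star (u : Fin n) (iu : inC u ≡ true) where

      height : Fin n → ℕ
      height x = if x == u then 0 else 1

      height-par : ∀ x → inC x ≡ true → x ≢ u → height u < height x
      height-par x _ x≢u rewrite ==-refl u | ≢⇒==false x≢u = s≤s z≤n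

      height-≤ : ∀ x → inC x ≡ true → height x ≤ 1
      height-≤ x _ with x == u
      ... | true  = z≤n
      ... | false = ≤-refl

      open CliqueTree (λ _ → u) height u 1 (λ _ _ _ → iu) height-par height-≤

      centre-cliqueDegree : cliqueDegree T u ≡ cliqueDegree A u
      centre-cliqueDegree = count-cong same V
        where
        same : ∀ w → T u w ∧ inC w ≡ A u w ∧ inC w
        same w = ∧-congʳ-when (inC w) λ iw → T≡A iw (w ≟ᶠ u)
          where
          T≡A : inC w ≡ true → Dec (w ≡ u) → T u w ≡ A u w
          T≡A _  (yes refl) = trans (T-irr u) (sym (adj-irr G u))
          T≡A iw (no w≢u)   = trans (T-child iw w≢u refl) (sym (clique u w iu iw (λ u≡w → w≢u (sym u≡w))))

      star-HIST : deg A u ≢ 2 → (∀ x → inC x ≡ true → x ≢ u → pendants x ≢ 1) → HasHIST G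
      star-HIST deg≢2 others-ok = hist clique-ok
        where
        clique-ok : ∀ x → inC x ≡ true → cliqueDegree T x + pendants x ≢ 2
        clique-ok x ix = by-cases (x ≟ᶠ u)
          where
          by-cases : Dec (x ≡ u) → cliqueDegree T x + pendants x ≢ 2
          by-cases (yes refl) e =
            deg≢2 (trans (deg-G u) (trans (cong (_+ pendants u) (sym centre-cliqueDegree)) e))
          by-cases (no x≢u) e = others-ok x ix x≢u (suc-injective (trans (cong (_+ pendants x) (sym leaf)) e))
            where leaf = cliqueDegree-leaf ix x≢u (λ _ _ _ u≡x → x≢u (sym u≡x))

    clique-degrees-two⇒K₃ : ∀ {u v} → Good G inC u → inC v ≡ true → u ≢ v →
                            (∀ x → inC x ≡ true → deg A x ≡ 2) → Isomorphic G (K 3)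
    clique-degrees-two⇒K₃ {u} {v} good-u@(iu , _) iv u≢v deg≡2 = isomorphic-K₃ G n≡3 adjacency
      where
      forced : ∀ {d q} → 1 ≤ d → d + q ≡ 2 → q ≢ 1 → d ≡ 2
      forced {suc zero}          _ e q≢1 = ⊥-elim (q≢1 (suc-injective e))
      forced {suc (suc zero)}    _ _ _   = refl
      forced {suc (suc (suc _))} _ () _

      sizeC≡3 : sizeC inC ≡ 3
      sizeC≡3 = trans (sizeC≡suc-cliqueDegree iu) (cong suc (forced
        (count-pos V (∈-allFin v) (cong₂ _∧_ (clique u v iu iv u≢v) iv))
        (trans (sym (deg-G u)) (deg≡2 u iu)) (Good⇒pendants≢1 good-u)))

      no-pendants : ∀ x → inC x ≡ true → pendants x ≡ 0
      no-pendants x ix = +-cancelˡ-≡ 2 _ _ (trans (cong (_+ pendants x) two) (trans (sym (deg-G x)) (deg≡2 x ix)))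
        where two = suc-injective (trans (sym sizeC≡3) (sizeC≡suc-cliqueDegree ix))

      all-inC : ∀ w → inC w ≡ true
      all-inC w with inC w in iw
      ... | true  = refl
      ... | false = ⊥-elim (<⇒≢ (count-pos V (∈-allFin w) has-pendant) (sym (no-pendants _ (attachment-inC iw))))
        where has-pendant = cong₂ _∧_ (trans (adj-sym G _ w) (attachment-adjacent iw)) (cong not iw)

      n≡3 : n ≡ 3
      n≡3 = trans (sym (trans (count-all all-inC V) (length-tabulate (λ x → x)))) sizeC≡3

      adjacency : ∀ a b → adj G a b ≡ not (a == b)
      adjacency a b with a ≟ᶠ b
      ... | yes refl = adj-irr G a
      ... | no a≢b   = clique a b (all-inC a) (all-inC b) a≢b

  Bad : Fin n → Set
  Bad x = inC x ≡ true × pendants x ≡ 1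

  bad? : Decidable Bad
  bad? x = (inC x ≟ᵇ true) ×-dec (pendants x ≟ 1)

  Good⇒¬Bad : ∀ {x} → Good G inC x → ¬ Bad x
  Good⇒¬Bad good (_ , p≡1) = Good⇒pendants≢1 good p≡1

  module PathTree (conn : Connected A) {u v b₀ : Fin n} (good-u : Good G inC u) (good-v : Good G inC v)
                  (u≢v : u ≢ v) (bad-b₀ : Bad b₀) where

    open Attachment conn u (proj₁ good-u)

    BadAbove BadBelow : Fin n → Fin n → Set
    BadAbove x y = Bad y × toℕ x < toℕ y
    BadBelow x y = Bad y × toℕ y < toℕ x

    bmin bmax : Fin n
    bmin = least bad? b₀
    bmax = greatest bad? b₀

    above? : ∀ x → Decidable (BadAbove x)
    above? x y = bad? y ×-dec (toℕ x <? toℕ y)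

    below? : ∀ x → Decidable (BadBelow x)
    below? x y = bad? y ×-dec (toℕ y <? toℕ x)

    next prev : Fin n → Fin n
    next x = least (above? x) bmax
    prev x = greatest (below? x) bmin

    bad-bmin : Bad bmin
    bad-bmin = least-satisfies bad? bad-b₀

    bad-bmax : Bad bmax
    bad-bmax = greatest-satisfies bad? bad-b₀

    ≤-bmax : ∀ {x} → Bad x → toℕ x ≤ toℕ bmax
    ≤-bmax = greatest-≥ bad?

    <-bmax : ∀ {x} → Bad x → x ≢ bmax → toℕ x < toℕ bmax
    <-bmax bx x≢bmax = ≤∧≢⇒< (≤-bmax bx) (λ e → x≢bmax (toℕ-injective e))

    bmin-< : ∀ {x} → Bad x → x ≢ bmin → toℕ bmin < toℕ x
    bmin-< bx x≢bmin = ≤∧≢⇒< (least-≤ bad? bx) (λ e → x≢bmin (toℕ-injective (sym e)))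

    ¬Bad⇒≢bmax : ∀ {x} → ¬ Bad x → x ≢ bmax
    ¬Bad⇒≢bmax ¬bx refl = ¬bx bad-bmax

    below⇒≢bmax : ∀ {x y} → Bad x → toℕ y < toℕ x → y ≢ bmax
    below⇒≢bmax bx y<x refl = <⇒≱ y<x (≤-bmax bx)

    next-above : ∀ {x} → Bad x → x ≢ bmax → BadAbove x (next x)
    next-above {x} bx x≢bmax = least-satisfies (above? x) (bad-bmax , <-bmax bx x≢bmax)

    prev-below : ∀ {x} → Bad x → x ≢ bmin → BadBelow x (prev x)
    prev-below {x} bx x≢bmin = greatest-satisfies (below? x) (bad-bmin , bmin-< bx x≢bmin)

    next-prev : ∀ {x} → Bad x → x ≢ bmin → next (prev x) ≡ x
    next-prev {x} bx x≢bmin = toℕ-injective (≤-antisym q≤x (≮⇒≥ q≮x))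
      where
      p = prev x
      p-below : BadBelow x p
      p-below = prev-below bx x≢bmin
      q-above : BadAbove p (next p)
      q-above = next-above (proj₁ p-below) (below⇒≢bmax bx (proj₂ p-below))
      q≤x : toℕ (next p) ≤ toℕ x
      q≤x = least-≤ (above? p) (bx , proj₂ p-below)
      q≮x : ¬ toℕ (next p) < toℕ x
      q≮x q<x = <⇒≱ (proj₂ q-above) (greatest-≥ (below? x) (proj₁ q-above , q<x))

    ¬bad-u : ¬ Bad u
    ¬bad-u = Good⇒¬Bad good-u

    ¬bad-v : ¬ Bad v
    ¬bad-v = Good⇒¬Bad good-v

    par : Fin n → Fin n
    par x = if does (bad? x) then next x else (if x == v then bmax else bmin)

    height : Fin n → ℕ
    height x = if does (bad? x) then n ∸ toℕ x else suc n

    par-bad : ∀ {x} → Bad x → par x ≡ next x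
    par-bad {x} bx rewrite dec-true (bad? x) bx = refl

    par-v : par v ≡ bmax
    par-v rewrite dec-false (bad? v) ¬bad-v | ==-refl v = refl

    par-other : ∀ {x} → ¬ Bad x → x ≢ v → par x ≡ bmin
    par-other {x} ¬bx x≢v rewrite dec-false (bad? x) ¬bx | ≢⇒==false x≢v = refl

    height-bad : ∀ {x} → Bad x → height x ≡ n ∸ toℕ x
    height-bad {x} bx rewrite dec-true (bad? x) bx = refl

    height-other : ∀ {x} → ¬ Bad x → height x ≡ suc n
    height-other {x} ¬bx rewrite dec-false (bad? x) ¬bx = refl

    height-≤ : ∀ x → height x ≤ suc n
    height-≤ x with does (bad? x)
    ... | true  = m≤n⇒m≤1+n (m∸n≤m n (toℕ x))
    ... | false = ≤-refl

    par-bad-vertex : ∀ x → x ≢ bmax → Bad (par x)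
    par-bad-vertex x x≢bmax = by-cases (bad? x) (x ≟ᶠ v)
      where
      by-cases : Dec (Bad x) → Dec (x ≡ v) → Bad (par x)
      by-cases (yes bx)  _          = subst Bad (sym (par-bad bx)) (proj₁ (next-above bx x≢bmax))
      by-cases (no _)    (yes refl) = subst Bad (sym par-v) bad-bmax
      by-cases (no ¬bx)  (no x≢v)   = subst Bad (sym (par-other ¬bx x≢v)) bad-bmin

    height-par : ∀ x → inC x ≡ true → x ≢ bmax → height (par x) < height x
    height-par x _ x≢bmax = by-cases (bad? x)
      where
      bad-par = par-bad-vertex x x≢bmax
      by-cases : Dec (Bad x) → height (par x) < height x
      by-cases (yes bx) = begin-strict
        height (par x)      ≡⟨ height-bad bad-par ⟩
        n ∸ toℕ (par x)     ≡⟨ cong (λ y → n ∸ toℕ y) (par-bad bx) ⟩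
        n ∸ toℕ (next x)    <⟨ ∸-monoʳ-< (proj₂ (next-above bx x≢bmax)) (<⇒≤ (toℕ<n (next x))) ⟩
        n ∸ toℕ x           ≡⟨ sym (height-bad bx) ⟩
        height x            ∎
        where open ≤-Reasoning
      by-cases (no ¬bx) = begin-strict
        height (par x)      ≡⟨ height-bad bad-par ⟩
        n ∸ toℕ (par x)     ≤⟨ m∸n≤m n (toℕ (par x)) ⟩
        n                   <⟨ ≤-refl ⟩
        suc n               ≡⟨ sym (height-other ¬bx) ⟩
        height x            ∎
        where open ≤-Reasoning

    open CliqueTree par height bmax (suc n) (λ x _ x≢bmax → proj₁ (par-bad-vertex x x≢bmax))
                    height-par (λ x _ → height-≤ x)

    lower-neighbour : ∀ {x} → Bad x →
                      Σ (Fin n) λ y → Edge T x y × inC y ≡ true × (y ≡ u ⊎ BadBelow x y)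
    lower-neighbour {x} bx = by-cases (x ≟ᶠ bmin)
      where
      by-cases : Dec (x ≡ bmin) → Σ (Fin n) λ y → Edge T x y × inC y ≡ true × (y ≡ u ⊎ BadBelow x y)
      by-cases (yes refl) =
        u , T-child (proj₁ good-u) (¬Bad⇒≢bmax ¬bad-u) (par-other ¬bad-u u≢v) , proj₁ good-u , inj₁ refl
      by-cases (no x≢bmin) =
        prev x , T-child (proj₁ bad-p) (below⇒≢bmax bx (proj₂ p-below)) par-p≡x , proj₁ bad-p , inj₂ p-below
        where
        p-below = prev-below bx x≢bmin
        bad-p = proj₁ p-below
        par-p≡x = trans (par-bad bad-p) (next-prev bx x≢bmin)

    upper-neighbour : ∀ {x} → Bad x →
                      Σ (Fin n) λ z → Edge T x z × inC z ≡ true × (z ≡ v ⊎ BadAbove x z)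
    upper-neighbour {x} bx = by-cases (x ≟ᶠ bmax)
      where
      by-cases : Dec (x ≡ bmax) → Σ (Fin n) λ z → Edge T x z × inC z ≡ true × (z ≡ v ⊎ BadAbove x z)
      by-cases (yes refl) = v , T-child (proj₁ good-v) (¬Bad⇒≢bmax ¬bad-v) par-v , proj₁ good-v , inj₁ refl
      by-cases (no x≢bmax) =
        next x , subst (Edge T x) (par-bad bx) (T-parent (proj₁ bx) x≢bmax) , proj₁ (proj₁ q-above) , inj₂ q-above
        where q-above = next-above bx x≢bmax

    lower≢upper : ∀ {x y z} → (y ≡ u ⊎ BadBelow x y) → (z ≡ v ⊎ BadAbove x z) → y ≢ z
    lower≢upper (inj₁ refl)        (inj₁ refl)        = u≢v
    lower≢upper (inj₁ refl)        (inj₂ (bz , _))    refl = ¬bad-u bz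
    lower≢upper (inj₂ (by , _))    (inj₁ refl)        refl = ¬bad-v by
    lower≢upper (inj₂ (_ , y<x))   (inj₂ (_ , x<z))   refl = <-asym y<x x<z

    bad-cliqueDegree : ∀ {x} → Bad x → 2 ≤ cliqueDegree T x
    bad-cliqueDegree bx =
      let y , xy , iy , lower = lower-neighbour bx
          z , xz , iz , upper = upper-neighbour bx
      in cliqueDegree-two xy iy xz iz (lower≢upper lower upper)

    path-HIST : HasHIST G
    path-HIST = hist clique-ok
      where
      clique-ok : ∀ x → inC x ≡ true → cliqueDegree T x + pendants x ≢ 2
      clique-ok x ix = by-cases (bad? x)
        where
        by-cases : Dec (Bad x) → cliqueDegree T x + pendants x ≢ 2
        by-cases (yes bx) e =
          <-irrefl refl (subst (3 ≤_) e (+-mono-≤ (bad-cliqueDegree bx) (≤-reflexive (sym (proj₂ bx)))))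
        by-cases (no ¬bx) e = ¬bx (ix , suc-injective (trans (cong (_+ pendants x) (sym leaf)) e))
          where
          leaf = cliqueDegree-leaf ix (¬Bad⇒≢bmax ¬bx) λ y _ y≢bmax py≡x →
                   ¬bx (subst Bad py≡x (par-bad-vertex y y≢bmax))

  sufficiency : Connected A → ¬ Isomorphic G (K 3) → AtLeastTwoGood G inC → HasHIST G
  sufficiency conn ¬K₃ (u , v , u≢v , good-u , good-v) = by-cases (any? bad?) (any? irregular?)
    where
    open Attachment conn u (proj₁ good-u)
    Irregular : Fin n → Set
    Irregular x = inC x ≡ true × deg A x ≢ 2
    irregular? : Decidable Irregular
    irregular? x = (inC x ≟ᵇ true) ×-dec ¬? (deg A x ≟ 2)
    by-cases : Dec (Σ (Fin n) Bad) → Dec (Σ (Fin n) Irregular) → HasHIST G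
    by-cases (yes (b₀ , bad-b₀)) _ = PathTree.path-HIST conn good-u good-v u≢v bad-b₀
    by-cases (no no-bad) (yes (c , ic , deg≢2)) =
      Star.star-HIST c ic deg≢2 (λ x ix _ p≡1 → no-bad (x , ix , p≡1))
    by-cases (no no-bad) (no regular) = ⊥-elim (¬K₃ (clique-degrees-two⇒K₃ good-u (proj₁ good-v) u≢v
      (λ x ix → decidable-stable (deg A x ≟ 2) (λ deg≢2 → regular (x , ix , deg≢2)))))

theorem2 : ∀ {n : ℕ} (G : Graph n) (inC : Fin n → Bool) →
    IsBlockSplit G inC → Connected (adj G) → ¬ IsTree (adj G) →
    ¬ Isomorphic G (K 3) →
    HasHIST G ⇔ AtLeastTwoGood G inC
theorem2 G inC block-split conn not-tree ¬K₃ = mk⇔ (necessity conn not-tree) (sufficiency conn ¬K₃)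
  where open BlockSplit G inC block-split
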